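{- There is no function $f$ such that $\chi_{\mathrm{so}}(G)\leq f(\chi_{\mathrm{iso}}(G),\chi(G))$ for all graphs $G$.
   Context: All graphs are finite and simple; $\chi(G)$ is the chromatic number. A proper vertex-coloring $\varphi\colon V(G)\to[t]$ is \emph{strong odd} if for every vertex $v$ and color $i$ the number $|N(v)\cap\varphi^{ -1}(i)|$ is zero or odd; $\chi_{\mathrm{so}}(G)$ is the minimum number of colors of a strong odd coloring. An \emph{improper strong odd coloring} is a vertex-coloring (not necessarily proper) with the same neighborhood condition; $\chi_{\mathrm{iso}}(G)$ is the minimum number of colors of an improper strong odd coloring of $G$. -}

module Defs where

open import Data.Nat using (ℕ; zero; suc; _<_; _%_)
open import Data.Bool using (Bool; true; false; _∧_)
open import Data.Fin using (Fin)
open import Data.Fin.Properties using (_≟_)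
open import Data.List using (List; length; filterᵇ)
open import Data.List.Base using (allFin)
open import Data.Sum using (_⊎_)
open import Data.Product using (∃)
open import Relation.Binary.PropositionalEquality using (_≡_; _≢_)
open import Relation.Nullary.Decidable using (⌊_⌋)
open import Relation.Nullary using (¬_)

record Graph : Set where
  field
    n     : ℕ
    adj   : Fin n → Fin n → Bool
    sym   : ∀ u v → adj u v ≡ adj v u
    irrefl : ∀ v → adj v v ≡ false
open Graph public

Coloring : Graph → ℕ → Set
Coloring G t = Fin (n G) → Fin t

Proper : (G : Graph) {t : ℕ} → Coloring G t → Set
Proper G φ = ∀ u v → adj G u v ≡ true → φ u ≢ φ v

nbrCount : (G : Graph) {t : ℕ} → Coloring G t → Fin (n G) → Fin t → ℕ
nbrCount G φ v i = length (filterᵇ (λ u → adj G v u ∧ ⌊ φ u ≟ i ⌋) (allFin (n G)))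

OddCond : (G : Graph) {t : ℕ} → Coloring G t → Set
OddCond G φ = ∀ v i → nbrCount G φ v i ≡ 0 ⊎ nbrCount G φ v i % 2 ≡ 1

IsProperColoring : (G : Graph) {t : ℕ} → Coloring G t → Set
IsProperColoring G φ = Proper G φ

IsStrongOdd : (G : Graph) {t : ℕ} → Coloring G t → Set
IsStrongOdd G φ = Proper G φ Data.Product.× OddCond G φ

IsImproperStrongOdd : (G : Graph) {t : ℕ} → Coloring G t → Set
IsImproperStrongOdd G φ = OddCond G φ

IsMinColors : (G : Graph) → (∀ {t} → Coloring G t → Set) → ℕ → Set
IsMinColors G P k =
  ∃ (λ (φ : Coloring G k) → P φ) Data.Product.×
  (∀ t → t < k → ¬ ∃ (λ (φ : Coloring G t) → P φ))

IsChromaticNumber : Graph → ℕ → Set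
IsChromaticNumber G = IsMinColors G (IsProperColoring G)

IsStrongOddChromaticNumber : Graph → ℕ → Set
IsStrongOddChromaticNumber G = IsMinColors G (IsStrongOdd G)

IsImproperStrongOddChromaticNumber : Graph → ℕ → Set
IsImproperStrongOddChromaticNumber G = IsMinColors G (IsImproperStrongOdd G)

-- Take m hubs and, for every pair (i , j) of hubs, a vertex pair i j adjacent to both and a
-- gate i j adjacent to both and to pair i j; give each hub a pendant leaf.  All degrees are
-- odd, so one colour is an improper strong odd colouring, and hubs / pairs and leaves / gates
-- is a proper 3-colouring of a graph with triangles.  In a strong odd colouring, distinct hubs i, j
-- of the same colour c would be the only c-coloured neighbours of pair i j, since gate i j is
-- adjacent to hub i; so the hubs are rainbow and χ_so ≥ m while χ_iso = 1 and χ = 3.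

module Submission where

open import Defs
open import Data.Nat using (ℕ; _≤_)
open import Data.Product using (∃)
open import Relation.Nullary using (¬_)

open import Data.Nat using (zero; suc; _+_; _*_; _<_; _%_; s≤s)
open import Data.Nat.Properties using (+-assoc; +-suc; +-identityʳ; ≤-trans; n≤1+n; <⇒≱)
open import Data.Nat.DivMod using ([m+kn]%n≡m%n)
open import Data.Nat.Tactic.RingSolver using (solve-∀)
open import Data.Bool using (Bool; true; false; _∧_; _∨_; _xor_; if_then_else_)
open import Data.Bool.Properties using (∧-identityʳ; ∧-zeroʳ; xor-is-ok; xor-same)
open import Data.Fin using (Fin; toℕ; fromℕ; fromℕ<; _↑ˡ_; _↑ʳ_; splitAt; combine; remQuot)
open import Data.Fin.Properties
  using (_≟_; ¬Fin0; all?; any?; injective⇒≤; ¬∀⟶∃¬-smallest; toℕ-fromℕ; toℕ-fromℕ<; toℕ-inject;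
         splitAt-↑ˡ; splitAt-↑ʳ; remQuot-combine; finToFun-funToFin)
open import Data.Fin.Base using (finToFun; funToFin)
open import Data.Fin.Patterns using (0F; 1F; 2F)
open import Data.List using (length; filterᵇ; tabulate)
open import Data.Sum using (_⊎_; inj₁; inj₂; [_,_]′)
open import Data.Product using (_×_; _,_; proj₁; proj₂; uncurry)
open import Data.Empty using (⊥-elim)
open import Function using (_∘_; id)
import Relation.Binary.PropositionalEquality as ≡
open ≡ using (_≡_; _≢_; refl; trans; cong; cong₂; subst; _≗_; module ≡-Reasoning)
open import Relation.Nullary using (Dec; yes; no; ¬?)
open import Relation.Nullary.Decidable
  using (⌊_⌋; isYes≗does; dec-true; dec-false; does-≡; decidable-stable; map′; _×-dec_; _⊎-dec_; _→-dec_)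
open import Relation.Unary using (Decidable)
import Data.Bool as Bool
import Data.Nat as Nat

_==_ : ∀ {k} → Fin k → Fin k → Bool
i == j = ⌊ i ≟ j ⌋

==-refl : ∀ {k} (i : Fin k) → i == i ≡ true
==-refl i = trans (isYes≗does (i ≟ i)) (dec-true (i ≟ i) refl)

==-≢ : ∀ {k} {i j : Fin k} → i ≢ j → i == j ≡ false
==-≢ {i = i} {j} i≢j = trans (isYes≗does (i ≟ j)) (dec-false (i ≟ j) i≢j)

==-comm : ∀ {k} (i j : Fin k) → i == j ≡ j == i
==-comm i j = trans (isYes≗does (i ≟ j))
  (trans (does-≡ (i ≟ j) (map′ ≡.sym ≡.sym (j ≟ i))) (≡.sym (isYes≗does (j ≟ i))))

==-suc : ∀ {k} (i j : Fin k) → Fin.suc i == Fin.suc j ≡ i == j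
==-suc i j with i ≟ j
... | yes _ = refl
... | no _  = refl

bit : Bool → ℕ
bit b = if b then 1 else 0

count : ∀ k → (Fin k → Bool) → ℕ
count zero    q = 0
count (suc k) q = bit (q Fin.zero) + count k (q ∘ Fin.suc)

length-filterᵇ-tabulate : ∀ {a} {A : Set a} {k} (p : A → Bool) (f : Fin k → A) →
                          length (filterᵇ p (tabulate f)) ≡ count k (p ∘ f)
length-filterᵇ-tabulate {k = zero}  p f = refl
length-filterᵇ-tabulate {k = suc k} p f with p (f Fin.zero)
... | true  = cong suc (length-filterᵇ-tabulate p (f ∘ Fin.suc))
... | false = length-filterᵇ-tabulate p (f ∘ Fin.suc)

count-cong : ∀ k {p q : Fin k → Bool} → p ≗ q → count k p ≡ count k q
count-cong zero    e = refl
count-cong (suc k) e = cong₂ _+_ (cong bit (e Fin.zero)) (count-cong k (e ∘ Fin.suc))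

count-none : ∀ k {q : Fin k → Bool} → (∀ i → q i ≡ false) → count k q ≡ 0
count-none zero    e = refl
count-none (suc k) e rewrite e Fin.zero = count-none k (e ∘ Fin.suc)

count-∧-at : ∀ k (p : Fin k → Bool) (a : Fin k) → count k (λ u → p u ∧ u == a) ≡ bit (p a)
count-∧-at (suc k) p Fin.zero rewrite ∧-identityʳ (p Fin.zero)
  | count-none k {λ u → p (Fin.suc u) ∧ false} (λ u → ∧-zeroʳ (p (Fin.suc u))) =
  +-identityʳ (bit (p Fin.zero))
count-∧-at (suc k) p (Fin.suc a) rewrite ∧-zeroʳ (p Fin.zero) =
  trans (count-cong k (λ u → cong (p (Fin.suc u) ∧_) (==-suc u a))) (count-∧-at k (p ∘ Fin.suc) a)

count-at : ∀ k (a : Fin k) → count k (_== a) ≡ 1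
count-at k = count-∧-at k (λ _ → true)

count-∨ : ∀ k {p q : Fin k → Bool} → (∀ i → p i ∧ q i ≡ false) →
          count k (λ i → p i ∨ q i) ≡ count k p + count k q
count-∨ zero    e = refl
count-∨ (suc k) {p} {q} e with p Fin.zero | q Fin.zero | e Fin.zero
... | true  | true  | ()
... | true  | false | _ = cong suc (count-∨ k (e ∘ Fin.suc))
... | false | true  | _ = trans (cong suc (count-∨ k (e ∘ Fin.suc)))
                                (≡.sym (+-suc (count k (p ∘ Fin.suc)) _))
... | false | false | _ = count-∨ k (e ∘ Fin.suc)

count-xor-same : ∀ k (i : Fin k) → count k (λ l → l == i xor l == i) ≡ 0
count-xor-same k i = count-none k (λ l → xor-same (l == i))

count-xor-pair : ∀ k {i j : Fin k} → i ≢ j → count k (λ l → l == i xor l == j) ≡ 2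
count-xor-pair k {i} {j} i≢j = begin
  count k (λ l → l == i xor l == j)  ≡⟨ count-cong k xor≗∨ ⟩
  count k (λ l → l == i ∨ l == j)    ≡⟨ count-∨ k disjoint ⟩
  count k (_== i) + count k (_== j)  ≡⟨ cong₂ _+_ (count-at k i) (count-at k j) ⟩
  2                                  ∎
  where
  open ≡-Reasoning
  disjoint : ∀ l → l == i ∧ l == j ≡ false
  disjoint l with l ≟ i
  ... | yes refl = ==-≢ i≢j
  ... | no _     = refl
  xor≗∨ : ∀ l → (l == i xor l == j) ≡ (l == i ∨ l == j)
  xor≗∨ l rewrite xor-is-ok (l == i) (l == j) | disjoint l = ∧-identityʳ _

count-+ : ∀ a b (q : Fin (a + b) → Bool) →
          count (a + b) q ≡ count a (q ∘ (_↑ˡ b)) + count b (q ∘ (a ↑ʳ_))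
count-+ zero    b q = refl
count-+ (suc a) b q = trans (cong (bit (q Fin.zero) +_) (count-+ a b (q ∘ Fin.suc)))
                            (≡.sym (+-assoc (bit (q Fin.zero)) _ _))

count² : ∀ a b → (Fin a → Fin b → Bool) → ℕ
count² zero    b r = 0
count² (suc a) b r = count b (r Fin.zero) + count² a b (r ∘ Fin.suc)

count-combine : ∀ a b (q : Fin (a * b) → Bool) → count (a * b) q ≡ count² a b (λ i j → q (combine i j))
count-combine zero    b q = refl
count-combine (suc a) b q =
  trans (count-+ b (a * b) q) (cong (count b (q ∘ (_↑ˡ a * b)) +_) (count-combine a b (q ∘ (b ↑ʳ_))))

count²-cong : ∀ a b {r s : Fin a → Fin b → Bool} → (∀ i j → r i j ≡ s i j) → count² a b r ≡ count² a b s
count²-cong zero    b e = refl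
count²-cong (suc a) b e = cong₂ _+_ (count-cong b (e Fin.zero)) (count²-cong a b (e ∘ Fin.suc))

count²-none : ∀ a b {r : Fin a → Fin b → Bool} → (∀ i j → r i j ≡ false) → count² a b r ≡ 0
count²-none zero    b e = refl
count²-none (suc a) b e rewrite count-none b (e Fin.zero) = count²-none a b (e ∘ Fin.suc)

count²-at : ∀ a b (i : Fin a) (j : Fin b) → count² a b (λ i′ j′ → i′ == i ∧ j′ == j) ≡ 1
count²-at (suc a) b Fin.zero j =
  cong₂ _+_ (count-at b j) (count²-none a b (λ _ _ → refl))
count²-at (suc a) b (Fin.suc i) j =
  cong₂ _+_ (count-none b (λ _ → refl))
            (trans (count²-cong a b (λ i′ j′ → cong (_∧ j′ == j) (==-suc i′ i))) (count²-at a b i j))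

bit-zero-or-odd : ∀ b → bit b ≡ 0 ⊎ bit b % 2 ≡ 1
bit-zero-or-odd true  = inj₂ refl
bit-zero-or-odd false = inj₁ refl

double+1-odd : ∀ r → (r + (r + 1)) % 2 ≡ 1
double+1-odd r = trans (cong (_% 2) (double+1 r)) ([m+kn]%n≡m%n 1 r 2)
  where
  double+1 : ∀ r → r + (r + 1) ≡ 1 + r * 2
  double+1 = solve-∀

rainbow⇒≤ : ∀ {k t} (ψ : Fin k → Fin t) → (∀ a b → a ≢ b → ψ a ≢ ψ b) → k ≤ t
rainbow⇒≤ ψ rainbow = injective⇒≤ λ {a} {b} e → decidable-stable (a ≟ b) (λ a≢b → rainbow a b a≢b e)

∃-least : (Q : ℕ → Set) → Decidable Q → ∀ k → Q k → ∃ λ s → Q s × (∀ t → t < s → ¬ Q t)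
∃-least Q Q? k qk
  with ¬∀⟶∃¬-smallest (suc k) (¬_ ∘ Q ∘ toℕ) (¬? ∘ Q? ∘ toℕ)
                      (λ none → none (fromℕ k) (subst Q (≡.sym (toℕ-fromℕ k)) qk))
... | i , ¬¬qi , below = toℕ i , decidable-stable (Q? (toℕ i)) ¬¬qi , below′
  where
  below′ : ∀ t → t < toℕ i → ¬ Q t
  below′ t t<i = subst (¬_ ∘ Q) (trans (toℕ-inject (fromℕ< t<i)) (toℕ-fromℕ< t<i)) (below (fromℕ< t<i))

∃-colouring? : ∀ {N t} {P : (Fin N → Fin t) → Set} → (∀ {φ ψ} → φ ≗ ψ → P φ → P ψ) → Decidable P → Dec (∃ P)
∃-colouring? {P = P} resp P? =
  map′ (λ (c , p) → finToFun c , p) (λ (φ , p) → funToFin φ , resp (≡.sym ∘ finToFun-funToFin φ) p)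
       (any? (P? ∘ finToFun))

module _ (G : Graph) where

  nbrCount≡count : ∀ {t} (φ : Coloring G t) v i → nbrCount G φ v i ≡ count (n G) (λ u → adj G v u ∧ φ u == i)
  nbrCount≡count φ v i = length-filterᵇ-tabulate (λ u → adj G v u ∧ φ u == i) id

  Proper-resp-≗ : ∀ {t} {φ ψ : Coloring G t} → φ ≗ ψ → Proper G φ → Proper G ψ
  Proper-resp-≗ φ≗ψ pr u v uv e = pr u v uv (trans (φ≗ψ u) (trans e (≡.sym (φ≗ψ v))))

  OddCond-resp-≗ : ∀ {t} {φ ψ : Coloring G t} → φ ≗ ψ → OddCond G φ → OddCond G ψ
  OddCond-resp-≗ {φ = φ} {ψ} φ≗ψ odd v i = subst (λ c → c ≡ 0 ⊎ c % 2 ≡ 1) same (odd v i)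
    where
    same : nbrCount G φ v i ≡ nbrCount G ψ v i
    same = trans (nbrCount≡count φ v i) (trans (count-cong (n G) (λ u → cong (λ c → adj G v u ∧ c == i) (φ≗ψ u)))
                                                (≡.sym (nbrCount≡count ψ v i)))

  Proper? : ∀ {t} → Decidable (Proper G {t})
  Proper? φ = all? λ u → all? λ v → (adj G u v Bool.≟ true) →-dec ¬? (φ u ≟ φ v)

  OddCond? : ∀ {t} → Decidable (OddCond G {t})
  OddCond? φ = all? λ v → all? λ i → (nbrCount G φ v i Nat.≟ 0) ⊎-dec (nbrCount G φ v i % 2 Nat.≟ 1)

  id-isStrongOdd : IsStrongOdd G {n G} id
  id-isStrongOdd = proper , odd
    where
    proper : Proper G id
    proper u v uv refl with () ← trans (≡.sym (irrefl G u)) uv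
    odd : OddCond G id
    odd v i rewrite nbrCount≡count id v i | count-∧-at (n G) (adj G v) i = bit-zero-or-odd (adj G v i)

  strongOddChromaticNumber-exists : ∃ (IsStrongOddChromaticNumber G)
  strongOddChromaticNumber-exists = ∃-least (λ t → ∃ (IsStrongOdd G {t})) ∃strongOdd? (n G) (id , id-isStrongOdd)
    where
    ∃strongOdd? : ∀ t → Dec (∃ (IsStrongOdd G {t}))
    ∃strongOdd? t = ∃-colouring? (λ φ≗ψ (pr , odd) → Proper-resp-≗ φ≗ψ pr , OddCond-resp-≗ φ≗ψ odd)
                                 (λ φ → Proper? φ ×-dec OddCond? φ)

  clique⇒≤ : ∀ {k t} (τ : Fin k → Fin (n G)) → (∀ a b → a ≢ b → adj G (τ a) (τ b) ≡ true) →
             (φ : Coloring G t) → Proper G φ → k ≤ t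
  clique⇒≤ τ clique φ proper = rainbow⇒≤ (φ ∘ τ) (λ a b a≢b → proper (τ a) (τ b) (clique a b a≢b))

module Construction (m : ℕ) where

  data Vertex : Set where
    hub       : Fin m → Vertex
    pair gate : Fin m → Fin m → Vertex
    leaf      : Fin m → Vertex

  -- With xor, a diagonal pair i = i is joined to no hub: pair i i and gate i i form a
  -- pendant edge, and every other pair and gate has degree 3.
  adjacent : Vertex → Vertex → Bool
  adjacent (hub k)    (pair i j)   = k == i xor k == j
  adjacent (hub k)    (gate i j)   = k == i xor k == j
  adjacent (hub k)    (leaf l)     = k == l
  adjacent (pair i j) (hub k)      = k == i xor k == j
  adjacent (pair i j) (gate i′ j′) = i == i′ ∧ j == j′
  adjacent (gate i j) (hub k)      = k == i xor k == j
  adjacent (gate i j) (pair i′ j′) = i′ == i ∧ j′ == j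
  adjacent (leaf l)   (hub k)      = k == l
  adjacent _          _            = false

  adjacent-sym : ∀ v w → adjacent v w ≡ adjacent w v
  adjacent-sym (hub _)    (hub _)    = refl
  adjacent-sym (hub _)    (pair _ _) = refl
  adjacent-sym (hub _)    (gate _ _) = refl
  adjacent-sym (hub _)    (leaf _)   = refl
  adjacent-sym (pair _ _) (hub _)    = refl
  adjacent-sym (pair _ _) (pair _ _) = refl
  adjacent-sym (pair _ _) (gate _ _) = refl
  adjacent-sym (pair _ _) (leaf _)   = refl
  adjacent-sym (gate _ _) (hub _)    = refl
  adjacent-sym (gate _ _) (pair _ _) = refl
  adjacent-sym (gate _ _) (gate _ _) = refl
  adjacent-sym (gate _ _) (leaf _)   = refl
  adjacent-sym (leaf _)   (hub _)    = refl
  adjacent-sym (leaf _)   (pair _ _) = refl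
  adjacent-sym (leaf _)   (gate _ _) = refl
  adjacent-sym (leaf _)   (leaf _)   = refl

  adjacent-irrefl : ∀ v → adjacent v v ≡ false
  adjacent-irrefl (hub _)    = refl
  adjacent-irrefl (pair _ _) = refl
  adjacent-irrefl (gate _ _) = refl
  adjacent-irrefl (leaf _)   = refl

  order : ℕ
  order = m + (m * m + (m * m + m))

  encode : Vertex → Fin order
  encode (hub k)    = k ↑ˡ (m * m + (m * m + m))
  encode (pair i j) = m ↑ʳ (combine i j ↑ˡ (m * m + m))
  encode (gate i j) = m ↑ʳ (m * m ↑ʳ (combine i j ↑ˡ m))
  encode (leaf k)   = m ↑ʳ (m * m ↑ʳ (m * m ↑ʳ k))

  decode : Fin order → Vertex
  decode u = [ hub , [ uncurry pair ∘ remQuot m , [ uncurry gate ∘ remQuot m , leaf ]′ ∘ splitAt (m * m) ]′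
                     ∘ splitAt (m * m) ]′ (splitAt m u)

  decode-encode : ∀ v → decode (encode v) ≡ v
  decode-encode (hub k) rewrite splitAt-↑ˡ m k (m * m + (m * m + m)) = refl
  decode-encode (pair i j)
    rewrite splitAt-↑ʳ m (m * m + (m * m + m)) (combine i j ↑ˡ (m * m + m))
          | splitAt-↑ˡ (m * m) (combine i j) (m * m + m) = cong (uncurry pair) (remQuot-combine i j)
  decode-encode (gate i j)
    rewrite splitAt-↑ʳ m (m * m + (m * m + m)) (m * m ↑ʳ (combine i j ↑ˡ m))
          | splitAt-↑ʳ (m * m) (m * m + m) (combine i j ↑ˡ m)
          | splitAt-↑ˡ (m * m) (combine i j) m = cong (uncurry gate) (remQuot-combine i j)
  decode-encode (leaf k)
    rewrite splitAt-↑ʳ m (m * m + (m * m + m)) (m * m ↑ʳ (m * m ↑ʳ k))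
          | splitAt-↑ʳ (m * m) (m * m + m) (m * m ↑ʳ k)
          | splitAt-↑ʳ (m * m) m k = refl

  G : Graph
  G = record
    { n      = order
    ; adj    = λ u v → adjacent (decode u) (decode v)
    ; sym    = λ u v → adjacent-sym (decode u) (decode v)
    ; irrefl = adjacent-irrefl ∘ decode
    }

  adj-encode : ∀ v w → adj G (encode v) (encode w) ≡ adjacent v w
  adj-encode v w = cong₂ adjacent (decode-encode v) (decode-encode w)

  countV : (Vertex → Bool) → ℕ
  countV q = count m (q ∘ hub) + (count² m m (λ i j → q (pair i j)) +
             (count² m m (λ i j → q (gate i j)) + count m (q ∘ leaf)))

  countV-cong : ∀ {p q} → p ≗ q → countV p ≡ countV q
  countV-cong e = cong₂ _+_ (count-cong m (e ∘ hub))
    (cong₂ _+_ (count²-cong m m (λ i j → e (pair i j)))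
      (cong₂ _+_ (count²-cong m m (λ i j → e (gate i j))) (count-cong m (e ∘ leaf))))

  count-encode : (q : Fin order → Bool) → count order q ≡ countV (q ∘ encode)
  count-encode q = trans (count-+ m _ q) (cong (count m (q ∘ encode ∘ hub) +_)
    (trans (count-+ (m * m) _ _) (cong₂ _+_ (count-combine m m _)
      (trans (count-+ (m * m) m _) (cong (_+ count m (q ∘ encode ∘ leaf)) (count-combine m m _))))))

  nbrCount-countV : ∀ {t} (φ : Coloring G t) u c →
                    nbrCount G φ u c ≡ countV (λ w → adjacent (decode u) w ∧ φ (encode w) == c)
  nbrCount-countV φ u c = trans (nbrCount≡count G φ u c) (trans (count-encode _)
    (countV-cong (λ w → cong (λ v → adjacent (decode u) v ∧ φ (encode w) == c) (decode-encode w))))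

  degree : Vertex → ℕ
  degree v = countV (adjacent v)

  private
    zeros : count m (λ _ → false) ≡ 0
    zeros = count-none m (λ _ → refl)

    zeros² : count² m m (λ _ _ → false) ≡ 0
    zeros² = count²-none m m (λ _ _ → refl)

  hub-neighbours+1-odd : (i j : Fin m) → (count m (λ k → k == i xor k == j) + 1) % 2 ≡ 1
  hub-neighbours+1-odd i j with i ≟ j
  ... | yes refl rewrite count-xor-same m i = refl
  ... | no i≢j   rewrite count-xor-pair m i≢j = refl

  degree-odd : ∀ v → degree v % 2 ≡ 1
  degree-odd (hub k) = trans (cong (_% 2) degree≡) (double+1-odd pairs)
    where
    pairs : ℕ
    pairs = count² m m (λ i j → k == i xor k == j)
    degree≡ : degree (hub k) ≡ pairs + (pairs + 1)
    degree≡ = cong₂ (λ a b → a + (pairs + (pairs + b))) zeros (trans (count-cong m (==-comm k)) (count-at m k))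
  degree-odd (pair i j) =
    trans (cong (λ d → (count m (λ k → k == i xor k == j) + d) % 2) others≡1) (hub-neighbours+1-odd i j)
    where
    others≡1 : count² m m (λ _ _ → false) + (count² m m (λ i′ j′ → i == i′ ∧ j == j′) + count m (λ _ → false)) ≡ 1
    others≡1 = cong₂ _+_ zeros² (cong₂ _+_ gate≡1 zeros)
      where
      gate≡1 : count² m m (λ i′ j′ → i == i′ ∧ j == j′) ≡ 1
      gate≡1 = trans (count²-cong m m (λ i′ j′ → cong₂ _∧_ (==-comm i i′) (==-comm j j′))) (count²-at m m i j)
  degree-odd (gate i j) =
    trans (cong (λ d → (count m (λ k → k == i xor k == j) + d) % 2) others≡1) (hub-neighbours+1-odd i j)
    where
    others≡1 : count² m m (λ i′ j′ → i′ == i ∧ j′ == j) + (count² m m (λ _ _ → false) + count m (λ _ → false)) ≡ 1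
    others≡1 = cong₂ _+_ (count²-at m m i j) (cong₂ _+_ zeros² zeros)
  degree-odd (leaf l) = cong (_% 2) (cong₂ _+_ (count-at m l) (cong₂ _+_ zeros² (cong₂ _+_ zeros² zeros)))

  monochromatic : Coloring G 1
  monochromatic _ = Fin.zero

  monochromatic-isImproperStrongOdd : IsImproperStrongOdd G monochromatic
  monochromatic-isImproperStrongOdd u Fin.zero = inj₂ (trans (cong (_% 2) deg≡) (degree-odd (decode u)))
    where
    deg≡ : nbrCount G monochromatic u Fin.zero ≡ degree (decode u)
    deg≡ = trans (nbrCount-countV monochromatic u Fin.zero) (countV-cong (λ w → ∧-identityʳ (adjacent (decode u) w)))

  improperStrongOddChromaticNumber≡1 : Fin m → IsImproperStrongOddChromaticNumber G 1
  improperStrongOddChromaticNumber≡1 k = (monochromatic , monochromatic-isImproperStrongOdd) , fewer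
    where
    fewer : ∀ t → t < 1 → ¬ ∃ (IsImproperStrongOdd G {t})
    fewer zero    _ (φ , _) = ¬Fin0 (φ (encode (hub k)))
    fewer (suc t) (s≤s ())

  layer : Vertex → Fin 3
  layer (hub _)    = 0F
  layer (pair _ _) = 1F
  layer (gate _ _) = 2F
  layer (leaf _)   = 1F

  layer-proper : ∀ v w → adjacent v w ≡ true → layer v ≢ layer w
  layer-proper (hub _)    (hub _)    ()
  layer-proper (hub _)    (pair _ _) _ ()
  layer-proper (hub _)    (gate _ _) _ ()
  layer-proper (hub _)    (leaf _)   _ ()
  layer-proper (pair _ _) (hub _)    _ ()
  layer-proper (pair _ _) (pair _ _) ()
  layer-proper (pair _ _) (gate _ _) _ ()
  layer-proper (pair _ _) (leaf _)   ()
  layer-proper (gate _ _) (hub _)    _ ()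
  layer-proper (gate _ _) (pair _ _) _ ()
  layer-proper (gate _ _) (gate _ _) ()
  layer-proper (gate _ _) (leaf _)   ()
  layer-proper (leaf _)   (hub _)    _ ()
  layer-proper (leaf _)   (pair _ _) ()
  layer-proper (leaf _)   (gate _ _) ()
  layer-proper (leaf _)   (leaf _)   ()

  hub-adjacent : ∀ {i j} → i ≢ j → adjacent (hub i) (pair i j) ≡ true
  hub-adjacent {i} {j} i≢j rewrite ==-refl i | ==-≢ i≢j = refl

  triangle : Fin m → Fin m → Fin 3 → Vertex
  triangle i j 0F = hub i
  triangle i j 1F = pair i j
  triangle i j 2F = gate i j

  triangle-clique : ∀ {i j} → i ≢ j → ∀ a b → a ≢ b → adjacent (triangle i j a) (triangle i j b) ≡ true
  triangle-clique i≢j 0F 0F a≢b = ⊥-elim (a≢b refl)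
  triangle-clique i≢j 0F 1F _   = hub-adjacent i≢j
  triangle-clique i≢j 0F 2F _   = hub-adjacent i≢j
  triangle-clique i≢j 1F 0F _   = hub-adjacent i≢j
  triangle-clique i≢j 1F 1F a≢b = ⊥-elim (a≢b refl)
  triangle-clique {i} {j} _ 1F 2F _ rewrite ==-refl i | ==-refl j = refl
  triangle-clique i≢j 2F 0F _   = hub-adjacent i≢j
  triangle-clique {i} {j} _ 2F 1F _ rewrite ==-refl i | ==-refl j = refl
  triangle-clique i≢j 2F 2F a≢b = ⊥-elim (a≢b refl)

  chromaticNumber≡3 : {i j : Fin m} → i ≢ j → IsChromaticNumber G 3
  chromaticNumber≡3 {i} {j} i≢j = (layer ∘ decode , λ u v → layer-proper (decode u) (decode v)) , fewer
    where
    fewer : ∀ t → t < 3 → ¬ ∃ (IsProperColoring G {t})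
    fewer t t<3 (φ , proper) = <⇒≱ t<3 (clique⇒≤ G (encode ∘ triangle i j)
      (λ a b a≢b → trans (adj-encode (triangle i j a) (triangle i j b)) (triangle-clique i≢j a b a≢b)) φ proper)

  strongOdd-hubs-rainbow : ∀ {t} {φ : Coloring G t} → IsStrongOdd G φ →
                           ∀ i j → i ≢ j → φ (encode (hub i)) ≢ φ (encode (hub j))
  strongOdd-hubs-rainbow {t} {φ} (proper , odd) i j i≢j same =
    [ (λ ()) , (λ ()) ]′ (subst (λ d → d ≡ 0 ⊎ d % 2 ≡ 1) sees-c-twice (odd (encode (pair i j)) c))
    where
    c : Fin t
    c = φ (encode (hub i))

    hub-term : ∀ k → (k == i xor k == j) ∧ φ (encode (hub k)) == c ≡ (k == i xor k == j)
    hub-term k with k ≟ i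
    ... | yes refl rewrite ==-≢ i≢j | ==-refl c = refl
    ... | no _ with k ≟ j
    ...   | yes refl = trans (isYes≗does (_ ≟ c)) (dec-true (_ ≟ c) (≡.sym same))
    ...   | no _     = refl

    gate-term : ∀ i′ j′ → (i == i′ ∧ j == j′) ∧ φ (encode (gate i′ j′)) == c ≡ false
    gate-term i′ j′ with i ≟ i′ | j ≟ j′
    ... | yes refl | yes refl = ==-≢ (proper _ _ (trans (adj-encode (gate i j) (hub i)) (hub-adjacent i≢j)))
    ... | yes refl | no _     = refl
    ... | no _     | _        = refl

    sees-c-twice : nbrCount G φ (encode (pair i j)) c ≡ 2
    sees-c-twice = begin
      nbrCount G φ (encode (pair i j)) c
        ≡⟨ nbrCount-countV φ (encode (pair i j)) c ⟩
      countV (λ w → adjacent (decode (encode (pair i j))) w ∧ φ (encode w) == c)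
        ≡⟨ countV-cong (λ w → cong (λ v → adjacent v w ∧ φ (encode w) == c) (decode-encode (pair i j))) ⟩
      countV (λ w → adjacent (pair i j) w ∧ φ (encode w) == c)
        ≡⟨ cong₂ _+_ (trans (count-cong m hub-term) (count-xor-pair m i≢j))
                     (cong₂ _+_ zeros² (cong₂ _+_ (count²-none m m gate-term) zeros)) ⟩
      2 ∎
      where open ≡-Reasoning

  strongOdd-colours-≥ : ∀ {t} {φ : Coloring G t} → IsStrongOdd G φ → m ≤ t
  strongOdd-colours-≥ {φ = φ} strongOdd = rainbow⇒≤ (φ ∘ encode ∘ hub) (strongOdd-hubs-rainbow strongOdd)

  strongOddChromaticNumber-≥ : ∀ {so} → IsStrongOddChromaticNumber G so → m ≤ so
  strongOddChromaticNumber-≥ ((_ , strongOdd) , _) = strongOdd-colours-≥ strongOdd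

proposition20 : ¬ ∃ (λ (f : ℕ → ℕ → ℕ) → ∀ (G : Graph) (so iso c : ℕ) → IsStrongOddChromaticNumber G so → IsImproperStrongOddChromaticNumber G iso → IsChromaticNumber G c → so ≤ f iso c)
proposition20 (f , bounded) = <⇒≱ (n≤1+n (suc (f 1 3))) (≤-trans hubs≤so so≤f)
  where
  open Construction (2 + f 1 3)
  χso : ∃ (IsStrongOddChromaticNumber G)
  χso = strongOddChromaticNumber-exists G
  so≤f : proj₁ χso ≤ f 1 3
  so≤f = bounded G (proj₁ χso) 1 3 (proj₂ χso) (improperStrongOddChromaticNumber≡1 0F)
                 (chromaticNumber≡3 {0F} {1F} (λ ()))
  hubs≤so : 2 + f 1 3 ≤ proj₁ χso
  hubs≤so = strongOddChromaticNumber-≥ (proj₂ χso)
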